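{- For any freshness environment $\nabla$, nominal substitution $\sigma$ and nominal term $t$ with $\mathrm{Vars}(t)\subseteq\mathrm{Dom}(\sigma)$, we have $[\sigma]_\nabla([t]_\emptyset)=[\sigma(t)]_\nabla$ (equality of $\lambda$-terms modulo $\alpha\beta\eta$).
   Context: Nominal setting: atoms (each of a sort of atoms), variables $X$ with sorts, function symbols; nominal terms $t::=f(t_1,\dots,t_n)\mid a\mid a.t\mid\pi\cdot X$, with $\pi$ a permutation (finite sequence of swappings of same-sort atoms, acting on atoms, and on terms homomorphically with $(a\,b)\cdot(c.t)=((a\,b)\cdot c).((a\,b)\cdot t)$ and $\pi\cdot(\pi'\cdot X)=(\pi\pi')\cdot X$). $\mathrm{Vars}(t)$ is the set of variables of $t$. A nominal substitution $\sigma=[X_1\mapsto t_1,\dots,X_k\mapsto t_k]$ has domain $\mathrm{Dom}(\sigma)=\{X_1,\dots,X_k\}$ and replaces variables without renaming (atom capture allowed), with $\sigma(\pi\cdot X)=\pi\cdot\sigma(X)$. A freshness environment is a finite set of constraints $a\#X$. Translation (standing assumption: a fixed ordered list $\langle a_1,\dots,a_n\rangle$ of pairwise distinct atoms containing all atoms under consideration). Base types named by sorts; $[\nu]=\nu$, $[\delta]=\delta$, $[\langle\nu\rangle\tau]=\nu\to[\tau]$, $[\tau_1\times\cdots\times\tau_n\to\tau]=[\tau_1]\to\cdots\to[\tau_n]\to[\tau]$; atom $a$ becomes a $\lambda$-variable $a$, function symbol $f$ a constant $f$. $[a]_\nabla=a$, $[f(t_1,\dots,t_n)]_\nabla=f([t_1]_\nabla,\dots)$,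 $[a.t]_\nabla=\lambda a.[t]_\nabla$, $[\pi\cdot X]_\nabla=X([\pi\cdot b_1]_\nabla,\dots,[\pi\cdot b_m]_\nabla)$ where $\langle b_1,\dots,b_m\rangle$ is the order-preserving sublist of $\langle a_1,\dots,a_n\rangle$ of atoms $a$ with $a\#X\notin\nabla$ and $X$ denotes the free $\lambda$-variable named $X$ of type $[\nu_1]\to\cdots\to[\nu_m]\to[\tau]$ (a $\lambda$-variable is determined by name and type, so different $\nabla$ may yield different $\lambda$-variables). For a nominal substitution, $[\sigma]_\nabla=\bigcup_{X\in\mathrm{Dom}(\sigma)}[X\mapsto\lambda a_1.\cdots\lambda a_n.[\sigma(X)]_\nabla]$, where the replaced $X$ is the $\lambda$-variable with $n$ arguments (the head of $[X]_\emptyset$). -}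

module Defs where

open import Data.Nat using (ℕ; zero; suc; _<ᵇ_; _≡ᵇ_; pred)
open import Data.Fin using (Fin)
open import Data.Fin.Properties using () renaming (_≟_ to _≟F_)
open import Data.List using (List; []; _∷_; _++_; map; foldr; filter; concatMap)
open import Data.List.Relation.Unary.All using (All)
open import Data.List.Relation.Unary.AllPairs using (AllPairs)
open import Data.List.Relation.Unary.Any using (any?)
open import Data.List.Membership.Propositional using (_∈_)
open import Data.Maybe using (Maybe; just; nothing)
open import Data.Product using (_×_; _,_; proj₁; proj₂)
open import Data.Product.Properties using (≡-dec)
open import Data.Sum using (_⊎_; inj₁; inj₂)
open import Data.Bool using (Bool; true; false; if_then_else_)
open import Relation.Nullary using (¬_; yes; no; Dec)
open import Relation.Nullary.Decidable using (¬?; _×-dec_)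
open import Relation.Binary.Definitions using (DecidableEquality)
open import Relation.Binary.PropositionalEquality using (_≡_; _≢_; refl; cong; cong₂)
open import Relation.Binary.Construct.Closure.Equivalence using (EqClosure)

data NSort (A D : Set) : Set where
  atomS : A → NSort A D
  dataS : D → NSort A D
  absS  : A → NSort A D → NSort A D

-- A nominal signature together with the standing assumption:
-- the atoms under consideration are exactly the entries of a fixed
-- ordered list ⟨a₁,…,aₙ⟩ of pairwise distinct atoms, represented as
-- Fin n (the order of Fin n is the order of the list).

record Sig : Set₁ where
  field
    AtomSort  : Set
    DataSort  : Set
    _≟A_      : DecidableEquality AtomSort
    _≟D_      : DecidableEquality DataSort
    n         : ℕ
    atomSort  : Fin n → AtomSort
    Var       : Set
    _≟V_      : DecidableEquality Var
    varSort   : Var → NSort AtomSort DataSort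
    FunSym    : Set
    funArgs   : FunSym → List (NSort AtomSort DataSort)
    funRes    : FunSym → NSort AtomSort DataSort

module Nominal (S : Sig) where
  open Sig S

  Atom : Set
  Atom = Fin n

  Sort : Set
  Sort = NSort AtomSort DataSort

  record Swap : Set where
    constructor swp
    field
      left     : Atom
      right    : Atom
      sameSort : atomSort left ≡ atomSort right

  Perm : Set
  Perm = List Swap

  swapAtom : Swap → Atom → Atom
  swapAtom (swp a b _) c with c ≟F a
  ... | yes _ = b
  ... | no _ with c ≟F b
  ...   | yes _ = a
  ...   | no _ = c

  -- (s₁ s₂ ⋯ sₖ)·c = s₁·(s₂·(⋯(sₖ·c)))  ;  so (π ++ π')·c = π·(π'·c)
  permAtom : Perm → Atom → Atom
  permAtom [] c = c
  permAtom (s ∷ π) c = swapAtom s (permAtom π c)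

  data Term : Set where
    fun  : FunSym → List Term → Term
    atm  : Atom → Term
    abs  : Atom → Term → Term
    susp : Perm → Var → Term

  mutual
    data WS : Term → Sort → Set where
      ws-fun  : ∀ {f ts} → WSs ts (funArgs f) → WS (fun f ts) (funRes f)
      ws-atm  : ∀ {a} → WS (atm a) (atomS (atomSort a))
      ws-abs  : ∀ {a t τ} → WS t τ → WS (abs a t) (absS (atomSort a) τ)
      ws-susp : ∀ {π X} → WS (susp π X) (varSort X)

    data WSs : List Term → List Sort → Set where
      []  : WSs [] []
      _∷_ : ∀ {t ts τ τs} → WS t τ → WSs ts τs → WSs (t ∷ ts) (τ ∷ τs)

  mutual
    permTerm : Perm → Term → Term
    permTerm π (fun f ts)   = fun f (permTerms π ts)
    permTerm π (atm a)      = atm (permAtom π a)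
    permTerm π (abs a t)    = abs (permAtom π a) (permTerm π t)
    permTerm π (susp π' X)  = susp (π ++ π') X

    permTerms : Perm → List Term → List Term
    permTerms π []       = []
    permTerms π (t ∷ ts) = permTerm π t ∷ permTerms π ts

  mutual
    vars : Term → List Var
    vars (fun f ts)  = varsL ts
    vars (atm a)     = []
    vars (abs a t)   = vars t
    vars (susp π X)  = X ∷ []

    varsL : List Term → List Var
    varsL []       = []
    varsL (t ∷ ts) = vars t ++ varsL ts

  NSubst : Set
  NSubst = List (Var × Term)

  dom : NSubst → List Var
  dom σ = map proj₁ σ

  WellFormedSubst : NSubst → Set
  WellFormedSubst σ = AllPairs _≢_ (dom σ)

  SortRespecting : NSubst → Set
  SortRespecting σ = All (λ p → WS (proj₂ p) (varSort (proj₁ p))) σ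

  lookupS : NSubst → Var → Maybe Term
  lookupS [] X = nothing
  lookupS ((Y , s) ∷ σ) X with X ≟V Y
  ... | yes _ = just s
  ... | no _  = lookupS σ X

  -- application σ(t), no renaming; σ(π·X) = π·σ(X)
  mutual
    applyS : NSubst → Term → Term
    applyS σ (fun f ts)  = fun f (applySs σ ts)
    applyS σ (atm a)     = atm a
    applyS σ (abs a t)   = abs a (applyS σ t)
    applyS σ (susp π X) with lookupS σ X
    ... | just s  = permTerm π s
    ... | nothing = susp π X

    applySs : NSubst → List Term → List Term
    applySs σ []       = []
    applySs σ (t ∷ ts) = applyS σ t ∷ applySs σ ts

  -- Freshness environments: finite sets of constraints a # X
  FreshEnv : Set
  FreshEnv = List (Atom × Var)

  data Ty : Set where
    base : AtomSort ⊎ DataSort → Ty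
    _⇒_  : Ty → Ty → Ty

  infixr 5 _⇒_

  _≟B_ : DecidableEquality (AtomSort ⊎ DataSort)
  inj₁ x ≟B inj₁ y with x ≟A y
  ... | yes refl = yes refl
  ... | no ne = no λ { refl → ne refl }
  inj₁ x ≟B inj₂ y = no λ ()
  inj₂ x ≟B inj₁ y = no λ ()
  inj₂ x ≟B inj₂ y with x ≟D y
  ... | yes refl = yes refl
  ... | no ne = no λ { refl → ne refl }

  _≟T_ : DecidableEquality Ty
  base x ≟T base y with x ≟B y
  ... | yes refl = yes refl
  ... | no ne = no λ { refl → ne refl }
  base x ≟T (_ ⇒ _) = no λ ()
  (_ ⇒ _) ≟T base y = no λ ()
  (a ⇒ b) ≟T (c ⇒ d) with a ≟T c | b ≟T d
  ... | yes refl | yes refl = yes refl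
  ... | no ne | _ = no λ { refl → ne refl }
  ... | _ | no ne = no λ { refl → ne refl }

  ⟦_⟧S : Sort → Ty
  ⟦ atomS ν ⟧S  = base (inj₁ ν)
  ⟦ dataS δ ⟧S  = base (inj₂ δ)
  ⟦ absS ν τ ⟧S = base (inj₁ ν) ⇒ ⟦ τ ⟧S

  -- λ-terms: bound variables as de Bruijn indices (so α-equivalence is
  -- syntactic identity); free λ-variables are named: an atom a (of type
  -- [sort a]) or a variable determined by a name X and a type.

  data FV : Set where
    atomV : Atom → FV
    metaV : Var → Ty → FV

  data Tm : Set where
    bvar : ℕ → Tm
    fvar : FV → Tm
    con  : FunSym → Tm
    app  : Tm → Tm → Tm
    lam  : Tm → Tm

  apps : Tm → List Tm → Tm
  apps h []       = h
  apps h (u ∷ us) = apps (app h u) us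

  shift : ℕ → Tm → Tm
  shift c (bvar i)  = if i <ᵇ c then bvar i else bvar (suc i)
  shift c (fvar x)  = fvar x
  shift c (con f)   = con f
  shift c (app t u) = app (shift c t) (shift c u)
  shift c (lam t)   = lam (shift (suc c) t)

  shiftN : ℕ → Tm → Tm
  shiftN zero    t = t
  shiftN (suc k) t = shift 0 (shiftN k t)

  inst : ℕ → Tm → Tm → Tm
  inst k u (bvar i)  = if i <ᵇ k then bvar i
                       else (if i ≡ᵇ k then shiftN k u else bvar (pred i))
  inst k u (fvar x)  = fvar x
  inst k u (con f)   = con f
  inst k u (app t v) = app (inst k u t) (inst k u v)
  inst k u (lam t)   = lam (inst (suc k) u t)

  -- abstr a d t : turn the free λ-variable a into the index bound by a
  -- new binder placed at depth d (dangling indices ≥ d shifted up)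
  abstr : Atom → ℕ → Tm → Tm
  abstr a d (bvar i)  = if i <ᵇ d then bvar i else bvar (suc i)
  abstr a d (fvar (atomV b)) with a ≟F b
  ... | yes _ = bvar d
  ... | no _  = fvar (atomV b)
  abstr a d (fvar (metaV X τ)) = fvar (metaV X τ)
  abstr a d (con f)   = con f
  abstr a d (app t u) = app (abstr a d t) (abstr a d u)
  abstr a d (lam t)   = lam (abstr a (suc d) t)

  lamA : Atom → Tm → Tm
  lamA a t = lam (abstr a 0 t)

  lamsA : List Atom → Tm → Tm
  lamsA []       t = t
  lamsA (b ∷ bs) t = lamA b (lamsA bs t)

  data _⟶_ : Tm → Tm → Set where
    β    : ∀ {t u} → app (lam t) u ⟶ inst 0 u t
    η    : ∀ {t} → lam (app (shift 0 t) (bvar 0)) ⟶ t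
    appL : ∀ {t t' u} → t ⟶ t' → app t u ⟶ app t' u
    appR : ∀ {t u u'} → u ⟶ u' → app t u ⟶ app t u'
    ξ    : ∀ {t t'} → t ⟶ t' → lam t ⟶ lam t'

  _≈αβη_ : Tm → Tm → Set
  _≈αβη_ = EqClosure _⟶_

  allAtoms : List Atom
  allAtoms = Data.List.allFin n

  _∈∇?_ : (p : Atom × Var) (∇ : FreshEnv) → Dec (p ∈ ∇)
  p ∈∇? ∇ = any? (λ q → ≡-dec _≟F_ _≟V_ p q) ∇

  nonFresh : FreshEnv → Var → List Atom
  nonFresh ∇ X = filter (λ a → ¬? ((a , X) ∈∇? ∇)) allAtoms

  metaTy : List Atom → Var → Ty
  metaTy bs X = foldr (λ b τ → base (inj₁ (atomSort b)) ⇒ τ) ⟦ varSort X ⟧S bs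

  mutual
    ⟦_⟧_ : Term → FreshEnv → Tm
    ⟦ fun f ts ⟧ ∇  = apps (con f) (⟦ ts ⟧L ∇)
    ⟦ atm a ⟧ ∇     = fvar (atomV a)
    ⟦ abs a t ⟧ ∇   = lamA a (⟦ t ⟧ ∇)
    ⟦ susp π X ⟧ ∇  =
      apps (fvar (metaV X (metaTy (nonFresh ∇ X) X)))
           (map (λ b → fvar (atomV (permAtom π b))) (nonFresh ∇ X))

    ⟦_⟧L_ : List Term → FreshEnv → List Tm
    ⟦ [] ⟧L ∇     = []
    ⟦ t ∷ ts ⟧L ∇ = ⟦ t ⟧ ∇ ∷ ⟦ ts ⟧L ∇

  -- λ-substitutions of free λ-variables (simultaneous, capture-free:
  -- the replacement is shifted past the binders it goes under)

  LSubst : Set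
  LSubst = FV → Maybe Tm

  substL : LSubst → ℕ → Tm → Tm
  substL ρ d (bvar i) = bvar i
  substL ρ d (fvar x) with ρ x
  ... | just u  = shiftN d u
  ... | nothing = fvar x
  substL ρ d (con f)   = con f
  substL ρ d (app t u) = app (substL ρ d t) (substL ρ d u)
  substL ρ d (lam t)   = lam (substL ρ (suc d) t)

  -- [σ]_∇ = ⋃_{X ∈ Dom σ} [X ↦ λa₁.⋯λaₙ.[σ(X)]_∇], where the replaced X
  -- is the λ-variable with n arguments (head of [X]_∅)
  ⟦_⟧σ_ : NSubst → FreshEnv → LSubst
  (⟦ σ ⟧σ ∇) (atomV a) = nothing
  (⟦ σ ⟧σ ∇) (metaV X τ) with τ ≟T metaTy allAtoms X | lookupS σ X
  ... | yes _ | just s  = just (lamsA allAtoms (⟦ s ⟧ ∇))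
  ... | yes _ | nothing = nothing
  ... | no _  | _       = nothing

-- Applications and binders commute with the λ-substitution [σ]_∇, since its
-- replacements λa₁⋯λaₙ.[σ(X)]_∇ are closed and mention no atom, and abstracting an atom preserves
-- β- and η-steps. At a suspension, [π·X]_∅ = X (π·a₁) ⋯ (π·aₙ), so substituting yields
-- (λa₁⋯λaₙ.[σ(X)]_∇) (π·a₁) ⋯ (π·aₙ); n β-steps rename every atom a of [σ(X)]_∇ to π·a
-- (every atom is among a₁,…,aₙ), and renaming atoms by the injective map π commutes with the
-- translation, which gives [π·σ(X)]_∇.

module Submission where

open import Defs
open import Data.List using ([])
open import Data.List.Membership.Propositional using (_∈_)

open import Data.Bool using (true; false)
open import Data.Empty using (⊥-elim)
open import Data.Fin.Properties using () renaming (_≟_ to _≟F_)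
open import Data.List using (List; _∷_; _++_; map; length)
open import Data.List.Properties using (filter-all)
open import Data.List.Relation.Unary.All using (tabulate)
open import Data.List.Relation.Unary.Any using (here; there)
open import Data.List.Membership.Propositional.Properties using (∈-allFin; ∈-++⁺ˡ; ∈-++⁺ʳ)
import Data.List.Membership.DecPropositional as DecMembership
open import Data.Maybe using (just; nothing)
open import Data.Nat using (ℕ; zero; suc; _+_; _<_; _≤_; z≤n; s≤s; _<ᵇ_; _≡ᵇ_; pred; _<?_)
open import Data.Nat.Properties
  using (+-suc; +-identityʳ; ≤-trans; ≤-refl; m≤m+n; m<n⇒m<1+n; +-monoʳ-<; n<1+n; n≤1+n; <⇒≤; ≮⇒≥; <-cmp)
open import Data.Product using (∃; _×_; _,_; proj₁; proj₂)
open import Data.Unit using (⊤; tt)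
open import Function using (_∘_)
open import Relation.Nullary using (¬_; Dec; yes; no)
open import Relation.Nullary.Decidable using (¬?)
open import Relation.Binary.Definitions using (tri<; tri≈; tri>)
open import Relation.Binary.PropositionalEquality
  using (_≡_; _≢_; refl; sym; trans; cong; cong₂; subst; module ≡-Reasoning)
open import Relation.Binary.Construct.Closure.ReflexiveTransitive using (ε; _◅◅_)
open import Relation.Binary.Construct.Closure.Equivalence using (gmap; setoid; return)
import Relation.Binary.Reasoning.Setoid as SetoidReasoning
open import Relation.Binary.Bundles using (Setoid)

private
  <⇒<ᵇ≡true : ∀ {i k} → i < k → (i <ᵇ k) ≡ true
  <⇒<ᵇ≡true {zero}  {suc k} _       = refl
  <⇒<ᵇ≡true {suc i} {suc k} (s≤s p) = <⇒<ᵇ≡true p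

  ≥⇒<ᵇ≡false : ∀ {i k} → k ≤ i → (i <ᵇ k) ≡ false
  ≥⇒<ᵇ≡false {i}     {zero}  _       = refl
  ≥⇒<ᵇ≡false {suc i} {suc k} (s≤s p) = ≥⇒<ᵇ≡false p

  ≡ᵇ-refl : ∀ i → (i ≡ᵇ i) ≡ true
  ≡ᵇ-refl zero    = refl
  ≡ᵇ-refl (suc i) = ≡ᵇ-refl i

  >⇒≡ᵇ≡false : ∀ {i k} → k < i → (i ≡ᵇ k) ≡ false
  >⇒≡ᵇ≡false {suc i} {zero}  _       = refl
  >⇒≡ᵇ≡false {suc i} {suc k} (s≤s p) = >⇒≡ᵇ≡false p

module _ (S : Sig) where
  open Sig S
  open Nominal S
  open DecMembership (_≟F_ {n}) using (_∈?_)

  atom : Atom → Tm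
  atom b = fvar (atomV b)

  shift-bvar-< : ∀ {i c} → i < c → shift c (bvar i) ≡ bvar i
  shift-bvar-< p rewrite <⇒<ᵇ≡true p = refl

  shift-bvar-≥ : ∀ {i c} → c ≤ i → shift c (bvar i) ≡ bvar (suc i)
  shift-bvar-≥ p rewrite ≥⇒<ᵇ≡false p = refl

  abstr-bvar-< : ∀ {a i d} → i < d → abstr a d (bvar i) ≡ bvar i
  abstr-bvar-< p rewrite <⇒<ᵇ≡true p = refl

  abstr-bvar-≥ : ∀ {a i d} → d ≤ i → abstr a d (bvar i) ≡ bvar (suc i)
  abstr-bvar-≥ p rewrite ≥⇒<ᵇ≡false p = refl

  inst-bvar-< : ∀ {k u i} → i < k → inst k u (bvar i) ≡ bvar i
  inst-bvar-< p rewrite <⇒<ᵇ≡true p = refl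

  inst-bvar-≡ : ∀ k u → inst k u (bvar k) ≡ shiftN k u
  inst-bvar-≡ k u rewrite ≥⇒<ᵇ≡false (≤-refl {k}) | ≡ᵇ-refl k = refl

  inst-bvar-> : ∀ {k u i} → k < i → inst k u (bvar i) ≡ bvar (pred i)
  inst-bvar-> p rewrite ≥⇒<ᵇ≡false (<⇒≤ p) | >⇒≡ᵇ≡false p = refl

  abstr-atom-≡ : ∀ a d → abstr a d (atom a) ≡ bvar d
  abstr-atom-≡ a d with a ≟F a
  ... | yes _  = refl
  ... | no a≢a = ⊥-elim (a≢a refl)

  abstr-atom-≢ : ∀ {a b} d → a ≢ b → abstr a d (atom b) ≡ atom b
  abstr-atom-≢ {a} {b} d a≢b with a ≟F b
  ... | yes a≡b = ⊥-elim (a≢b a≡b)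
  ... | no _    = refl

  Closed : ℕ → Tm → Set
  Closed d (bvar i)  = i < d
  Closed d (fvar _)  = ⊤
  Closed d (con _)   = ⊤
  Closed d (app t u) = Closed d t × Closed d u
  Closed d (lam t)   = Closed (suc d) t

  Closed-mono : ∀ {d e} t → d ≤ e → Closed d t → Closed e t
  Closed-mono (bvar i)  d≤e p       = ≤-trans p d≤e
  Closed-mono (fvar _)  d≤e p       = tt
  Closed-mono (con _)   d≤e p       = tt
  Closed-mono (app t u) d≤e (p , q) = Closed-mono t d≤e p , Closed-mono u d≤e q
  Closed-mono (lam t)   d≤e p       = Closed-mono t (s≤s d≤e) p

  shift-closed : ∀ c t → Closed c t → shift c t ≡ t
  shift-closed c (bvar i)  p       = shift-bvar-< p
  shift-closed c (fvar _)  p       = refl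
  shift-closed c (con _)   p       = refl
  shift-closed c (app t u) (p , q) = cong₂ app (shift-closed c t p) (shift-closed c u q)
  shift-closed c (lam t)   p       = cong lam (shift-closed (suc c) t p)

  shiftN-closed : ∀ k t → Closed 0 t → shiftN k t ≡ t
  shiftN-closed zero    t p = refl
  shiftN-closed (suc k) t p = trans (cong (shift 0) (shiftN-closed k t p)) (shift-closed 0 t p)

  shiftN-fvar : ∀ k x → shiftN k (fvar x) ≡ fvar x
  shiftN-fvar zero    x = refl
  shiftN-fvar (suc k) x = cong (shift 0) (shiftN-fvar k x)

  abstr-closed : ∀ a d t → Closed d t → Closed (suc d) (abstr a d t)
  abstr-closed a d (bvar i) p = subst (Closed (suc d)) (sym (abstr-bvar-< {a} p)) (m<n⇒m<1+n p)
  abstr-closed a d (fvar (atomV b)) p with a ≟F b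
  ... | yes _ = n<1+n d
  ... | no _  = tt
  abstr-closed a d (fvar (metaV X τ)) p = tt
  abstr-closed a d (con _)   p       = tt
  abstr-closed a d (app t u) (p , q) = abstr-closed a d t p , abstr-closed a d u q
  abstr-closed a d (lam t)   p       = abstr-closed a (suc d) t p

  lamsA-closed : ∀ as B → Closed 0 B → Closed 0 (lamsA as B)
  lamsA-closed []       B p = p
  lamsA-closed (a ∷ as) B p = abstr-closed a 0 (lamsA as B) (lamsA-closed as B p)

  data Occurs (b : Atom) : Tm → Set where
    fvar  : Occurs b (atom b)
    appˡ  : ∀ {t u} → Occurs b t → Occurs b (app t u)
    appʳ  : ∀ {t u} → Occurs b u → Occurs b (app t u)
    lam   : ∀ {t} → Occurs b t → Occurs b (lam t)

  abstr-fresh : ∀ a d t → Closed d t → ¬ Occurs a t → abstr a d t ≡ t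
  abstr-fresh a d (bvar i) p a∉t = abstr-bvar-< {a} p
  abstr-fresh a d (fvar (atomV b)) p a∉t with a ≟F b
  ... | yes refl = ⊥-elim (a∉t fvar)
  ... | no _     = refl
  abstr-fresh a d (fvar (metaV X τ)) p a∉t = refl
  abstr-fresh a d (con _) p a∉t = refl
  abstr-fresh a d (app t u) (p , q) a∉t =
    cong₂ app (abstr-fresh a d t p (a∉t ∘ appˡ)) (abstr-fresh a d u q (a∉t ∘ appʳ))
  abstr-fresh a d (lam t) p a∉t = cong lam (abstr-fresh a (suc d) t p (a∉t ∘ lam))

  abstr-occurs : ∀ a d t {b} → Occurs b (abstr a d t) → b ≢ a × Occurs b t
  abstr-occurs a d (bvar i) o with i <ᵇ d
  abstr-occurs a d (bvar i) () | true
  abstr-occurs a d (bvar i) () | false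
  abstr-occurs a d (fvar (atomV c)) o with a ≟F c
  abstr-occurs a d (fvar (atomV c)) ()   | yes _
  abstr-occurs a d (fvar (atomV c)) fvar | no a≢c = (λ c≡a → a≢c (sym c≡a)) , fvar
  abstr-occurs a d (fvar (metaV X τ)) ()
  abstr-occurs a d (con _) ()
  abstr-occurs a d (app t u) (appˡ o) = let b≢a , o′ = abstr-occurs a d t o in b≢a , appˡ o′
  abstr-occurs a d (app t u) (appʳ o) = let b≢a , o′ = abstr-occurs a d u o in b≢a , appʳ o′
  abstr-occurs a d (lam t)   (lam o)  = let b≢a , o′ = abstr-occurs a (suc d) t o in b≢a , lam o′

  lamsA-binds : ∀ as B {b} → Occurs b (lamsA as B) → ¬ b ∈ as
  lamsA-binds (a ∷ as) B (lam o) (here b≡a) = proj₁ (abstr-occurs a 0 (lamsA as B) o) b≡a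
  lamsA-binds (a ∷ as) B (lam o) (there b∈as) =
    lamsA-binds as B (proj₂ (abstr-occurs a 0 (lamsA as B) o)) b∈as

  abstr-shift : ∀ a c e t → abstr a (suc (c + e)) (shift c t) ≡ shift c (abstr a (c + e) t)
  abstr-shift a c e (bvar i) with i <? c | i <? c + e
  ... | yes i<c | _ rewrite shift-bvar-< i<c
                          | abstr-bvar-< {a} (≤-trans i<c (m≤m+n c e))
                          | abstr-bvar-< {a} (≤-trans i<c (≤-trans (m≤m+n c e) (n≤1+n (c + e))))
                          | shift-bvar-< i<c = refl
  ... | no i≮c | yes i<c+e rewrite shift-bvar-≥ (≮⇒≥ i≮c)
                                 | abstr-bvar-< {a} i<c+e
                                 | abstr-bvar-< {a} (s≤s i<c+e)
                                 | shift-bvar-≥ (≮⇒≥ i≮c) = refl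
  ... | no i≮c | no i≮c+e rewrite shift-bvar-≥ (≮⇒≥ i≮c)
                                | abstr-bvar-≥ {a} (≮⇒≥ i≮c+e)
                                | abstr-bvar-≥ {a} (s≤s (≮⇒≥ i≮c+e))
                                | shift-bvar-≥ (≤-trans (≮⇒≥ i≮c) (n≤1+n i)) = refl
  abstr-shift a c e (fvar (atomV b)) with a ≟F b
  ... | yes _ = sym (shift-bvar-≥ (m≤m+n c e))
  ... | no _  = refl
  abstr-shift a c e (fvar (metaV X τ)) = refl
  abstr-shift a c e (con _)   = refl
  abstr-shift a c e (app t u) = cong₂ app (abstr-shift a c e t) (abstr-shift a c e u)
  abstr-shift a c e (lam t)   = cong lam (abstr-shift a (suc c) e t)

  abstr-shiftN : ∀ a k e u → abstr a (k + e) (shiftN k u) ≡ shiftN k (abstr a e u)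
  abstr-shiftN a zero    e u = refl
  abstr-shiftN a (suc k) e u =
    trans (abstr-shift a 0 (k + e) (shiftN k u)) (cong (shift 0) (abstr-shiftN a k e u))

  abstr-inst : ∀ a k e u t →
               abstr a (k + e) (inst k u t) ≡ inst k (abstr a e u) (abstr a (suc (k + e)) t)
  abstr-inst a k e u (bvar i) with <-cmp i k
  ... | tri< i<k _ _ rewrite inst-bvar-< {k} {u} i<k
                           | abstr-bvar-< {a} (≤-trans i<k (m≤m+n k e))
                           | abstr-bvar-< {a} (≤-trans i<k (≤-trans (m≤m+n k e) (n≤1+n (k + e))))
                           | inst-bvar-< {k} {abstr a e u} i<k = refl
  ... | tri≈ _ refl _ rewrite inst-bvar-≡ k u
                            | abstr-bvar-< {a} (s≤s (m≤m+n k e))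
                            | inst-bvar-≡ k (abstr a e u) = abstr-shiftN a k e u
  abstr-inst a k e u (bvar (suc j)) | tri> _ _ (s≤s k≤j) with j <? k + e
  ... | yes j<k+e rewrite inst-bvar-> {k} {u} (s≤s k≤j)
                        | abstr-bvar-< {a} j<k+e
                        | abstr-bvar-< {a} (s≤s j<k+e)
                        | inst-bvar-> {k} {abstr a e u} (s≤s k≤j) = refl
  ... | no j≮k+e rewrite inst-bvar-> {k} {u} (s≤s k≤j)
                       | abstr-bvar-≥ {a} (≮⇒≥ j≮k+e)
                       | abstr-bvar-≥ {a} (s≤s (≮⇒≥ j≮k+e))
                       | inst-bvar-> {k} {abstr a e u} (s≤s (≤-trans k≤j (n≤1+n j))) = refl
  abstr-inst a k e u (fvar (atomV b)) with a ≟F b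
  ... | yes _ = sym (inst-bvar-> {k} {abstr a e u} (s≤s (m≤m+n k e)))
  ... | no _  = refl
  abstr-inst a k e u (fvar (metaV X τ)) = refl
  abstr-inst a k e u (con _)   = refl
  abstr-inst a k e u (app t v) = cong₂ app (abstr-inst a k e u t) (abstr-inst a k e u v)
  abstr-inst a k e u (lam t)   = cong lam (abstr-inst a (suc k) e u t)

  abstr-⟶ : ∀ {a d t t′} → t ⟶ t′ → abstr a d t ⟶ abstr a d t′
  abstr-⟶ {a} {d} (β {t} {u}) =
    subst (app (lam (abstr a (suc d) t)) (abstr a d u) ⟶_) (sym (abstr-inst a 0 d u t)) β
  abstr-⟶ {a} {d} (η {t}) =
    subst (λ t′ → lam (app t′ (bvar 0)) ⟶ abstr a d t) (sym (abstr-shift a 0 d t)) η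
  abstr-⟶ (appL s) = appL (abstr-⟶ s)
  abstr-⟶ (appR s) = appR (abstr-⟶ s)
  abstr-⟶ (ξ s)    = ξ (abstr-⟶ s)

  open Setoid (setoid _⟶_) using () renaming (reflexive to ≈-reflexive)

  app-cong : ∀ {t t′ u u′} → t ≈αβη t′ → u ≈αβη u′ → app t u ≈αβη app t′ u′
  app-cong {t′ = t′} {u = u} t≈t′ u≈u′ =
    gmap (λ t → app t u) appL t≈t′ ◅◅ gmap (app t′) appR u≈u′

  lamA-cong : ∀ a {t t′} → t ≈αβη t′ → lamA a t ≈αβη lamA a t′
  lamA-cong a = gmap (lamA a) (ξ ∘ abstr-⟶)

  -- β-reducing λa₁⋯λaₙ.B applied to atoms

  lamN : ℕ → Tm → Tm
  lamN zero    t = t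
  lamN (suc m) t = lam (lamN m t)

  abstr-lamN : ∀ a d m t → abstr a d (lamN m t) ≡ lamN m (abstr a (d + m) t)
  abstr-lamN a d zero    t = cong (λ d′ → abstr a d′ t) (sym (+-identityʳ d))
  abstr-lamN a d (suc m) t =
    cong lam (trans (abstr-lamN a (suc d) m t) (cong (λ d′ → lamN m (abstr a d′ t)) (sym (+-suc d m))))

  inst-lamN : ∀ k u m t → inst k u (lamN m t) ≡ lamN m (inst (k + m) u t)
  inst-lamN k u zero    t = cong (λ k′ → inst k′ u t) (sym (+-identityʳ k))
  inst-lamN k u (suc m) t =
    cong lam (trans (inst-lamN (suc k) u m t) (cong (λ k′ → lamN m (inst k′ u t)) (sym (+-suc k m))))

  -- The body of lamsA as B under its binders: an atom followed by k others in as becomes index d + k.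
  abstrAll : List Atom → ℕ → Tm → Tm
  abstrAll []       d t = t
  abstrAll (a ∷ as) d t = abstr a (d + length as) (abstrAll as d t)

  lamsA≡lamN : ∀ as B → lamsA as B ≡ lamN (length as) (abstrAll as 0 B)
  lamsA≡lamN []       B = refl
  lamsA≡lamN (a ∷ as) B =
    cong lam (trans (cong (abstr a 0) (lamsA≡lamN as B)) (abstr-lamN a 0 (length as) (abstrAll as 0 B)))

  abstrAll-bvar-< : ∀ as d {i} → i < d → abstrAll as d (bvar i) ≡ bvar i
  abstrAll-bvar-< []       d i<d = refl
  abstrAll-bvar-< (a ∷ as) d i<d rewrite abstrAll-bvar-< as d i<d =
    abstr-bvar-< {a} (≤-trans i<d (m≤m+n d (length as)))

  abstrAll-meta : ∀ as d X τ → abstrAll as d (fvar (metaV X τ)) ≡ fvar (metaV X τ)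
  abstrAll-meta []       d X τ = refl
  abstrAll-meta (a ∷ as) d X τ rewrite abstrAll-meta as d X τ = refl

  abstrAll-con : ∀ as d f → abstrAll as d (con f) ≡ con f
  abstrAll-con []       d f = refl
  abstrAll-con (a ∷ as) d f rewrite abstrAll-con as d f = refl

  abstrAll-app : ∀ as d t u → abstrAll as d (app t u) ≡ app (abstrAll as d t) (abstrAll as d u)
  abstrAll-app []       d t u = refl
  abstrAll-app (a ∷ as) d t u rewrite abstrAll-app as d t u = refl

  abstrAll-lam : ∀ as d t → abstrAll as d (lam t) ≡ lam (abstrAll as (suc d) t)
  abstrAll-lam []       d t = refl
  abstrAll-lam (a ∷ as) d t rewrite abstrAll-lam as d t = refl

  abstrAll-atom∉ : ∀ as d {b} → ¬ b ∈ as → abstrAll as d (atom b) ≡ atom b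
  abstrAll-atom∉ []       d b∉as = refl
  abstrAll-atom∉ (a ∷ as) d b∉as rewrite abstrAll-atom∉ as d (b∉as ∘ there) =
    abstr-atom-≢ (d + length as) (λ a≡b → b∉as (here (sym a≡b)))

  apps-⟶ : ∀ us {t t′} → t ⟶ t′ → apps t us ⟶ apps t′ us
  apps-⟶ []       s = s
  apps-⟶ (u ∷ us) s = apps-⟶ us (appL s)

  renameAtoms : (Atom → Atom) → Tm → Tm
  renameAtoms φ (bvar i)           = bvar i
  renameAtoms φ (fvar (atomV b))   = atom (φ b)
  renameAtoms φ (fvar (metaV X τ)) = fvar (metaV X τ)
  renameAtoms φ (con f)            = con f
  renameAtoms φ (app t u)          = app (renameAtoms φ t) (renameAtoms φ u)
  renameAtoms φ (lam t)            = lam (renameAtoms φ t)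

  module _ (φ : Atom → Atom) where

    instAll : List Atom → ℕ → Tm → Tm
    instAll []       d t = t
    instAll (a ∷ as) d t = instAll as d (inst (d + length as) (atom (φ a)) t)

    lamN-β : ∀ as C → apps (lamN (length as) C) (map (atom ∘ φ) as) ≈αβη instAll as 0 C
    lamN-β []       C = ε
    lamN-β (a ∷ as) C =
      return (apps-⟶ (map (atom ∘ φ) as) β)
      ◅◅ ≈-reflexive (cong (λ t → apps t (map (atom ∘ φ) as)) (inst-lamN 0 (atom (φ a)) (length as) C))
      ◅◅ lamN-β as (inst (length as) (atom (φ a)) C)

    instAll-bvar-< : ∀ as d {i} → i < d → instAll as d (bvar i) ≡ bvar i
    instAll-bvar-< []       d i<d = refl
    instAll-bvar-< (a ∷ as) d i<d
      rewrite inst-bvar-< {d + length as} {atom (φ a)} (≤-trans i<d (m≤m+n d (length as))) =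
      instAll-bvar-< as d i<d

    instAll-fvar : ∀ as d x → instAll as d (fvar x) ≡ fvar x
    instAll-fvar []       d x = refl
    instAll-fvar (a ∷ as) d x = instAll-fvar as d x

    instAll-con : ∀ as d f → instAll as d (con f) ≡ con f
    instAll-con []       d f = refl
    instAll-con (a ∷ as) d f = instAll-con as d f

    instAll-app : ∀ as d t u → instAll as d (app t u) ≡ app (instAll as d t) (instAll as d u)
    instAll-app []       d t u = refl
    instAll-app (a ∷ as) d t u = instAll-app as d _ _

    instAll-lam : ∀ as d t → instAll as d (lam t) ≡ lam (instAll as (suc d) t)
    instAll-lam []       d t = refl
    instAll-lam (a ∷ as) d t = instAll-lam as d _

    abstrAll-atom∈ : ∀ as d {b} → b ∈ as →
                     ∃ λ k → k < length as × abstrAll as d (atom b) ≡ bvar (d + k)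
                                          × instAll as d (bvar (d + k)) ≡ atom (φ b)
    abstrAll-atom∈ (a ∷ as) d {b} b∈a∷as with b ∈? as
    ... | yes b∈as =
      let k , k<m , abs≡ , inst≡ = abstrAll-atom∈ as d b∈as
          d+k<d+m = +-monoʳ-< d k<m
      in k , m<n⇒m<1+n k<m
           , trans (cong (abstr a (d + length as)) abs≡) (abstr-bvar-< {a} d+k<d+m)
           , trans (cong (instAll as d) (inst-bvar-< {d + length as} {atom (φ a)} d+k<d+m)) inst≡
    ... | no b∉as with b∈a∷as
    ...   | there b∈as = ⊥-elim (b∉as b∈as)
    ...   | here refl =
      length as , n<1+n (length as)
      , trans (cong (abstr a (d + length as)) (abstrAll-atom∉ as d b∉as)) (abstr-atom-≡ a (d + length as))
      , (begin
          instAll as d (inst (d + length as) (atom (φ a)) (bvar (d + length as)))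
            ≡⟨ cong (instAll as d) (inst-bvar-≡ (d + length as) (atom (φ a))) ⟩
          instAll as d (shiftN (d + length as) (atom (φ a)))
            ≡⟨ cong (instAll as d) (shiftN-fvar (d + length as) (atomV (φ a))) ⟩
          instAll as d (atom (φ a))
            ≡⟨ instAll-fvar as d (atomV (φ a)) ⟩
          atom (φ a)
            ∎)
      where open ≡-Reasoning

    instAll∘abstrAll : ∀ as → (∀ b → b ∈ as) → ∀ d B → Closed d B →
                       instAll as d (abstrAll as d B) ≡ renameAtoms φ B
    instAll∘abstrAll as every d (bvar i) i<d
      rewrite abstrAll-bvar-< as d i<d = instAll-bvar-< as d i<d
    instAll∘abstrAll as every d (fvar (atomV b)) _ =
      let _ , _ , abs≡ , inst≡ = abstrAll-atom∈ as d (every b)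
      in trans (cong (instAll as d) abs≡) inst≡
    instAll∘abstrAll as every d (fvar (metaV X τ)) _
      rewrite abstrAll-meta as d X τ = instAll-fvar as d _
    instAll∘abstrAll as every d (con f) _
      rewrite abstrAll-con as d f = instAll-con as d f
    instAll∘abstrAll as every d (app t u) (t-closed , u-closed)
      rewrite abstrAll-app as d t u | instAll-app as d (abstrAll as d t) (abstrAll as d u) =
      cong₂ app (instAll∘abstrAll as every d t t-closed) (instAll∘abstrAll as every d u u-closed)
    instAll∘abstrAll as every d (lam t) t-closed
      rewrite abstrAll-lam as d t | instAll-lam as d (abstrAll as (suc d) t) =
      cong lam (instAll∘abstrAll as every (suc d) t t-closed)

    lamsA-β : ∀ as → (∀ b → b ∈ as) → ∀ B → Closed 0 B →
              apps (lamsA as B) (map (atom ∘ φ) as) ≈αβη renameAtoms φ B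
    lamsA-β as every B B-closed =
      ≈-reflexive (cong (λ t → apps t (map (atom ∘ φ) as)) (lamsA≡lamN as B))
      ◅◅ lamN-β as (abstrAll as 0 B)
      ◅◅ ≈-reflexive (instAll∘abstrAll as every 0 B B-closed)

  -- Permutations and the translation

  swapAtom-left : ∀ a b p → swapAtom (swp a b p) a ≡ b
  swapAtom-left a b p with a ≟F a
  ... | yes _  = refl
  ... | no a≢a = ⊥-elim (a≢a refl)

  swapAtom-right : ∀ a b p → swapAtom (swp a b p) b ≡ a
  swapAtom-right a b p with b ≟F a
  ... | yes b≡a = b≡a
  ... | no _ with b ≟F b
  ...   | yes _  = refl
  ...   | no b≢b = ⊥-elim (b≢b refl)

  swapAtom-other : ∀ a b p {c} → c ≢ a → c ≢ b → swapAtom (swp a b p) c ≡ c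
  swapAtom-other a b p {c} c≢a c≢b with c ≟F a
  ... | yes c≡a = ⊥-elim (c≢a c≡a)
  ... | no _ with c ≟F b
  ...   | yes c≡b = ⊥-elim (c≢b c≡b)
  ...   | no _    = refl

  swapAtom-involutive-cases : ∀ a b p c → Dec (c ≡ a) → Dec (c ≡ b) →
                              swapAtom (swp a b p) (swapAtom (swp a b p) c) ≡ c
  swapAtom-involutive-cases a b p c (yes refl) _ =
    trans (cong (swapAtom (swp c b p)) (swapAtom-left c b p)) (swapAtom-right c b p)
  swapAtom-involutive-cases a b p c (no _) (yes refl) =
    trans (cong (swapAtom (swp a c p)) (swapAtom-right a c p)) (swapAtom-left a c p)
  swapAtom-involutive-cases a b p c (no c≢a) (no c≢b) =
    trans (cong (swapAtom (swp a b p)) (swapAtom-other a b p c≢a c≢b)) (swapAtom-other a b p c≢a c≢b)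

  swapAtom-involutive : ∀ s c → swapAtom s (swapAtom s c) ≡ c
  swapAtom-involutive (swp a b p) c = swapAtom-involutive-cases a b p c (c ≟F a) (c ≟F b)

  permAtom-injective : ∀ π {x y} → permAtom π x ≡ permAtom π y → x ≡ y
  permAtom-injective []      eq = eq
  permAtom-injective (s ∷ π) {x} {y} eq = permAtom-injective π (begin
    permAtom π x                              ≡⟨ swapAtom-involutive s (permAtom π x) ⟨
    swapAtom s (swapAtom s (permAtom π x))    ≡⟨ cong (swapAtom s) eq ⟩
    swapAtom s (swapAtom s (permAtom π y))    ≡⟨ swapAtom-involutive s (permAtom π y) ⟩
    permAtom π y                              ∎)
    where open ≡-Reasoning

  permAtom-++ : ∀ π π′ b → permAtom (π ++ π′) b ≡ permAtom π (permAtom π′ b)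
  permAtom-++ []      π′ b = refl
  permAtom-++ (s ∷ π) π′ b = cong (swapAtom s) (permAtom-++ π π′ b)

  renameAtoms-abstr : ∀ φ → (∀ {x y} → φ x ≡ φ y → x ≡ y) → ∀ a d t →
                      renameAtoms φ (abstr a d t) ≡ abstr (φ a) d (renameAtoms φ t)
  renameAtoms-abstr φ φ-inj a d (bvar i) with i <ᵇ d
  ... | true  = refl
  ... | false = refl
  renameAtoms-abstr φ φ-inj a d (fvar (atomV b)) with a ≟F b | φ a ≟F φ b
  ... | yes _    | yes _     = refl
  ... | yes refl | no φa≢φa  = ⊥-elim (φa≢φa refl)
  ... | no a≢b   | yes φa≡φb = ⊥-elim (a≢b (φ-inj φa≡φb))
  ... | no _     | no _      = refl
  renameAtoms-abstr φ φ-inj a d (fvar (metaV X τ)) = refl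
  renameAtoms-abstr φ φ-inj a d (con f)   = refl
  renameAtoms-abstr φ φ-inj a d (app t u) =
    cong₂ app (renameAtoms-abstr φ φ-inj a d t) (renameAtoms-abstr φ φ-inj a d u)
  renameAtoms-abstr φ φ-inj a d (lam t) = cong lam (renameAtoms-abstr φ φ-inj a (suc d) t)

  renameAtoms-apps : ∀ φ h us → renameAtoms φ (apps h us) ≡ apps (renameAtoms φ h) (map (renameAtoms φ) us)
  renameAtoms-apps φ h []       = refl
  renameAtoms-apps φ h (u ∷ us) = renameAtoms-apps φ (app h u) us

  mutual
    ⟦⟧-permTerm : ∀ π s ∇ → ⟦ permTerm π s ⟧ ∇ ≡ renameAtoms (permAtom π) (⟦ s ⟧ ∇)
    ⟦⟧-permTerm π (fun f ts) ∇ =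
      trans (cong (apps (con f)) (⟦⟧L-permTerms π ts ∇))
            (sym (renameAtoms-apps (permAtom π) (con f) (⟦ ts ⟧L ∇)))
    ⟦⟧-permTerm π (atm a)    ∇ = refl
    ⟦⟧-permTerm π (abs a t)  ∇ =
      trans (cong (lamA (permAtom π a)) (⟦⟧-permTerm π t ∇))
            (cong lam (sym (renameAtoms-abstr (permAtom π) (permAtom-injective π) a 0 (⟦ t ⟧ ∇))))
    ⟦⟧-permTerm π (susp π′ X) ∇ =
      trans (cong (apps head) (map-permAtom-++ (nonFresh ∇ X)))
            (sym (renameAtoms-apps (permAtom π) head (map (atom ∘ permAtom π′) (nonFresh ∇ X))))
      where
        head = fvar (metaV X (metaTy (nonFresh ∇ X) X))
        map-permAtom-++ : ∀ bs → map (atom ∘ permAtom (π ++ π′)) bs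
                                 ≡ map (renameAtoms (permAtom π)) (map (atom ∘ permAtom π′) bs)
        map-permAtom-++ []       = refl
        map-permAtom-++ (b ∷ bs) = cong₂ _∷_ (cong atom (permAtom-++ π π′ b)) (map-permAtom-++ bs)

    ⟦⟧L-permTerms : ∀ π ts ∇ → ⟦ permTerms π ts ⟧L ∇ ≡ map (renameAtoms (permAtom π)) (⟦ ts ⟧L ∇)
    ⟦⟧L-permTerms π []       ∇ = refl
    ⟦⟧L-permTerms π (t ∷ ts) ∇ = cong₂ _∷_ (⟦⟧-permTerm π t ∇) (⟦⟧L-permTerms π ts ∇)

  apps-atoms-closed : ∀ (φ : Atom → Atom) bs h → Closed 0 h → Closed 0 (apps h (map (atom ∘ φ) bs))
  apps-atoms-closed φ []       h h-closed = h-closed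
  apps-atoms-closed φ (b ∷ bs) h h-closed = apps-atoms-closed φ bs (app h _) (h-closed , tt)

  mutual
    ⟦⟧-closed : ∀ t ∇ → Closed 0 (⟦ t ⟧ ∇)
    ⟦⟧-closed (fun f ts) ∇ = apps-⟦⟧L-closed ts ∇ (con f) tt
    ⟦⟧-closed (atm a)    ∇ = tt
    ⟦⟧-closed (abs a t)  ∇ = abstr-closed a 0 (⟦ t ⟧ ∇) (⟦⟧-closed t ∇)
    ⟦⟧-closed (susp π X) ∇ = apps-atoms-closed (permAtom π) (nonFresh ∇ X) _ tt

    apps-⟦⟧L-closed : ∀ ts ∇ h → Closed 0 h → Closed 0 (apps h (⟦ ts ⟧L ∇))
    apps-⟦⟧L-closed []       ∇ h h-closed = h-closed
    apps-⟦⟧L-closed (t ∷ ts) ∇ h h-closed = apps-⟦⟧L-closed ts ∇ (app h _) (h-closed , ⟦⟧-closed t ∇)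

  -- Applying [σ]_∇

  lookupS-∈dom : ∀ σ {X} → X ∈ dom σ → lookupS σ X ≢ nothing
  lookupS-∈dom ((Y , s) ∷ σ) {X} X∈dom with X ≟V Y
  ... | yes _ = λ ()
  ... | no X≢Y with X∈dom
  ...   | here X≡Y    = ⊥-elim (X≢Y X≡Y)
  ...   | there X∈dom′ = lookupS-∈dom σ X∈dom′

  ⟦susp⟧-∅ : ∀ π X → ⟦ susp π X ⟧ [] ≡
                     apps (fvar (metaV X (metaTy allAtoms X))) (map (atom ∘ permAtom π) allAtoms)
  ⟦susp⟧-∅ π X rewrite filter-all (λ a → ¬? ((a , X) ∈∇? [])) (tabulate {xs = allAtoms} λ _ ()) =
    refl

  substL-fvar : ∀ ρ d {x v} → ρ x ≡ just v → substL ρ d (fvar x) ≡ shiftN d v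
  substL-fvar ρ d {x} eq with ρ x
  substL-fvar ρ d refl | just v = refl

  substL-apps : ∀ ρ d h us → substL ρ d (apps h us) ≡ apps (substL ρ d h) (map (substL ρ d) us)
  substL-apps ρ d h []       = refl
  substL-apps ρ d h (u ∷ us) = substL-apps ρ d (app h u) us

  module _ (σ : NSubst) (∇ : FreshEnv) where

    private
      ρ : LSubst
      ρ = ⟦ σ ⟧σ ∇

    ⟦σ⟧-closed-atomFree : ∀ x {v} → ρ x ≡ just v → Closed 0 v × (∀ b → ¬ Occurs b v)
    ⟦σ⟧-closed-atomFree (metaV X τ) eq with τ ≟T metaTy allAtoms X | lookupS σ X
    ⟦σ⟧-closed-atomFree (metaV X τ) refl | yes _ | just s =
      lamsA-closed allAtoms (⟦ s ⟧ ∇) (⟦⟧-closed s ∇) ,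
      λ b b∈ → lamsA-binds allAtoms (⟦ s ⟧ ∇) b∈ (∈-allFin b)

    ⟦σ⟧-meta : ∀ X {s} → lookupS σ X ≡ just s →
               ρ (metaV X (metaTy allAtoms X)) ≡ just (lamsA allAtoms (⟦ s ⟧ ∇))
    ⟦σ⟧-meta X σX≡s with metaTy allAtoms X ≟T metaTy allAtoms X | lookupS σ X
    ⟦σ⟧-meta X refl | yes _ | _ = refl
    ⟦σ⟧-meta X _    | no τ≢τ | _ = ⊥-elim (τ≢τ refl)

    substL-abstr : ∀ a d t → substL ρ (suc d) (abstr a d t) ≡ abstr a d (substL ρ d t)
    substL-abstr a d (bvar i) with i <ᵇ d
    ... | true  = refl
    ... | false = refl
    substL-abstr a d (fvar (atomV b)) with a ≟F b
    ... | yes _ = refl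
    ... | no _  = refl
    substL-abstr a d (fvar (metaV X τ)) with ρ (metaV X τ) in eq
    ... | nothing = refl
    ... | just v  = let v-closed , v-atomFree = ⟦σ⟧-closed-atomFree (metaV X τ) eq in begin
      shiftN (suc d) v       ≡⟨ shiftN-closed (suc d) v v-closed ⟩
      v                      ≡⟨ abstr-fresh a d v (Closed-mono v z≤n v-closed) (v-atomFree a) ⟨
      abstr a d v            ≡⟨ cong (abstr a d) (shiftN-closed d v v-closed) ⟨
      abstr a d (shiftN d v) ∎
      where open ≡-Reasoning
    substL-abstr a d (con f)   = refl
    substL-abstr a d (app t u) = cong₂ app (substL-abstr a d t) (substL-abstr a d u)
    substL-abstr a d (lam t)   = cong lam (substL-abstr a (suc d) t)

    substL-atoms : ∀ (φ : Atom → Atom) bs → map (substL ρ 0) (map (atom ∘ φ) bs) ≡ map (atom ∘ φ) bs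
    substL-atoms φ []       = refl
    substL-atoms φ (b ∷ bs) = cong (atom (φ b) ∷_) (substL-atoms φ bs)

    substL-⟦susp⟧ : ∀ π X {s} → lookupS σ X ≡ just s →
                    substL ρ 0 (⟦ susp π X ⟧ []) ≈αβη (⟦ permTerm π s ⟧ ∇)
    substL-⟦susp⟧ π X {s} σX≡s = begin
      substL ρ 0 (⟦ susp π X ⟧ [])
        ≡⟨ cong (substL ρ 0) (⟦susp⟧-∅ π X) ⟩
      substL ρ 0 (apps Xₙ πas)
        ≡⟨ substL-apps ρ 0 Xₙ πas ⟩
      apps (substL ρ 0 Xₙ) (map (substL ρ 0) πas)
        ≡⟨ cong₂ apps (substL-fvar ρ 0 (⟦σ⟧-meta X σX≡s)) (substL-atoms (permAtom π) allAtoms) ⟩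
      apps (lamsA allAtoms (⟦ s ⟧ ∇)) πas
        ≈⟨ lamsA-β (permAtom π) allAtoms ∈-allFin (⟦ s ⟧ ∇) (⟦⟧-closed s ∇) ⟩
      renameAtoms (permAtom π) (⟦ s ⟧ ∇)
        ≡⟨ ⟦⟧-permTerm π s ∇ ⟨
      ⟦ permTerm π s ⟧ ∇
        ∎
      where
        open SetoidReasoning (setoid _⟶_)
        Xₙ  = fvar (metaV X (metaTy allAtoms X))
        πas = map (atom ∘ permAtom π) allAtoms

    mutual
      substL-⟦⟧ : ∀ t → (∀ X → X ∈ vars t → X ∈ dom σ) →
                  substL ρ 0 (⟦ t ⟧ []) ≈αβη (⟦ applyS σ t ⟧ ∇)
      substL-⟦⟧ (fun f ts) vars⊆dom = substL-apps-⟦⟧L ts vars⊆dom ε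
      substL-⟦⟧ (atm a)    vars⊆dom = ε
      substL-⟦⟧ (abs a t)  vars⊆dom =
        ≈-reflexive (cong lam (substL-abstr a 0 (⟦ t ⟧ []))) ◅◅ lamA-cong a (substL-⟦⟧ t vars⊆dom)
      substL-⟦⟧ (susp π X) vars⊆dom with lookupS σ X in σX≡
      ... | just s  = substL-⟦susp⟧ π X σX≡
      ... | nothing = ⊥-elim (lookupS-∈dom σ (vars⊆dom X (here refl)) σX≡)

      substL-apps-⟦⟧L : ∀ ts → (∀ X → X ∈ varsL ts → X ∈ dom σ) → ∀ {h h′} →
                        substL ρ 0 h ≈αβη h′ →
                        substL ρ 0 (apps h (⟦ ts ⟧L [])) ≈αβη apps h′ (⟦ applySs σ ts ⟧L ∇)
      substL-apps-⟦⟧L []       vars⊆dom h≈h′ = h≈h′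
      substL-apps-⟦⟧L (t ∷ ts) vars⊆dom h≈h′ =
        substL-apps-⟦⟧L ts (λ X → vars⊆dom X ∘ ∈-++⁺ʳ (vars t))
          (app-cong h≈h′ (substL-⟦⟧ t (λ X → vars⊆dom X ∘ ∈-++⁺ˡ)))

lemma5p11 : (S : Sig) → let open Nominal S in
    (∇ : FreshEnv) (σ : NSubst) (t : Term) →
    WellFormedSubst σ → SortRespecting σ →
    (τ : Sort) → WS t τ →
    (∀ X → X ∈ vars t → X ∈ dom σ) →
    substL (⟦ σ ⟧σ ∇) 0 (⟦ t ⟧ []) ≈αβη (⟦ applyS σ t ⟧ ∇)
lemma5p11 S ∇ σ t _ _ _ _ vars⊆dom = substL-⟦⟧ S σ ∇ t vars⊆dom
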